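{- For every integer $n\geq 3$ there exists a set of four $n$-sided dice $(A,B,C,D)$ that is balanced and non-transitive, i.e. $P(A\succ B)=P(B\succ C)=P(C\succ D)=P(D\succ A)>1/2$.
   Context: A set of four $n$-sided dice is an ordered quadruple $(A,B,C,D)$ of pairwise disjoint sets with $|A|=|B|=|C|=|D|=n$ and $A\cup B\cup C\cup D=\{1,2,\dots,4n\}$; each die is fair and dice are rolled independently. For dice $X,Y$, $P(X\succ Y)=\frac{1}{n^2}|\{(x,y)\in X\times Y: x>y\}|$ is the probability that the number rolled on $X$ exceeds that rolled on $Y$. Such a set is non-transitive if each of $P(A\succ B),P(B\succ C),P(C\succ D),P(D\succ A)$ exceeds $1/2$, and balanced if these four probabilities are equal. -}

module Defs where

open import Data.Nat using (ℕ; suc; _*_; _+_; _<?_; NonZero)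
open import Data.List using (List; length; filter; cartesianProduct; applyUpTo; _++_)
open import Data.List.Relation.Binary.Permutation.Propositional using (_↭_)
open import Data.Product using (_×_; _,_; proj₁; proj₂)
open import Data.Integer using (+_)
open import Data.Rational using (ℚ; _/_; _<_; ½)
open import Relation.Binary.PropositionalEquality using (_≡_)
open import Data.Nat.Properties using (m*n≢0)

Die : Set
Die = List ℕ

oneTo : ℕ → List ℕ
oneTo = applyUpTo suc

wins : Die → Die → ℕ
wins X Y = length (filter (λ p → proj₂ p <? proj₁ p) (cartesianProduct X Y))

P≻ : (n : ℕ) → .{{_ : NonZero n}} → Die → Die → ℚ
P≻ n X Y = _/_ (+ wins X Y) (n * n) {{m*n≢0 n n}}

IsDiceSet : ℕ → Die → Die → Die → Die → Set
IsDiceSet n A B C D =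
  length A ≡ n × length B ≡ n × length C ≡ n × length D ≡ n ×
  ((A ++ B ++ C ++ D) ↭ oneTo (4 * n))

NonTransitive : (n : ℕ) → .{{_ : NonZero n}} → Die → Die → Die → Die → Set
NonTransitive n A B C D =
  ½ < P≻ n A B × ½ < P≻ n B C × ½ < P≻ n C D × ½ < P≻ n D A

Balanced : (n : ℕ) → .{{_ : NonZero n}} → Die → Die → Die → Die → Set
Balanced n A B C D =
  P≻ n A B ≡ P≻ n B C × P≻ n B C ≡ P≻ n C D × P≻ n C D ≡ P≻ n D A

-- Induction on n in steps of two, from explicit sets for n = 3 and n = 4.
-- Given a set on the faces 1..4n in which every die beats the next one in
-- W of its n² face pairs, shift all faces up by 4 and give A, B, C, D the new
-- bottom faces 4, 3, 2, 1 and the new top faces 4n+5, 4n+6, 4n+7, 4n+8.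
-- An old face beats every bottom face and loses to every top face, and in
-- each consecutive pair exactly one of the two comparisons among the new
-- faces is won (bottoms for A>B, B>C, C>D, tops for D>A), so every win count
-- becomes W + 2n + 2. The set stays balanced, and n² < 2W gives
-- (n+2)² < 2(W + 2n + 2).
module Submission where

open import Defs
open import Data.Nat using (ℕ; _+_)
open import Data.Product using (Σ; _×_)

open import Function using (_∘_)
open import Data.Nat using (suc; _*_; _≤_; _<_; _<?_; s≤s; z≤n; z<s; NonZero)
open import Data.Nat.Properties
  using (≤-refl; ≤-trans; <⇒≤; ≤⇒≯; ≮⇒≥; ≤-<-trans; n≤1+n; m≤n+m; m<n+m; +-comm;
         *-identityˡ; *-identityʳ; +-monoˡ-≤; +-monoˡ-<; m*n≢0;
         +-commutativeSemigroup; ≤-decTotalOrder)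
open import Data.Nat.Tactic.RingSolver using (solve-∀)
open import Algebra.Properties.CommutativeSemigroup +-commutativeSemigroup using (interchange)
import Data.Integer as ℤ
import Data.Integer.Properties as ℤ
open import Data.Rational using (_/_; ½) renaming (_<_ to _<ℚ_)
open import Data.Rational.Properties using (toℚᵘ-cancel-<; toℚᵘ-fromℚᵘ)
open import Data.Rational.Unnormalised using (mkℚᵘ; *<*)
open import Data.Rational.Unnormalised.Properties using (<-respʳ-≃; ≃-sym)
open import Data.List using (List; []; _∷_; [_]; _++_; _∷ʳ_; length; filter; map; cartesianProduct)
open import Data.List.Properties
  using (filter-++; length-++; filter-all; filter-none; map-++; ++-assoc; ++-identityʳ;
         length-map; applyUpTo-∷ʳ; cartesianProductWith-distribʳ-++)
open import Data.List.Membership.Propositional using (_∈_)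
open import Data.List.Relation.Unary.All as All using (All; []; _∷_)
open import Data.List.Relation.Unary.All.Properties using (cartesianProduct⁺; applyUpTo⁺₁; ++⁻ˡ; ++⁻ʳ)
  renaming (map⁺ to All-map⁺)
open import Data.List.Relation.Binary.Permutation.Propositional
  using (_↭_; ↭-sym; ↭-trans; ↭-reflexive; ↭-refl; module PermutationReasoning)
open import Data.List.Relation.Binary.Permutation.Propositional.Properties
  using (All-resp-↭; ↭-reverse; ++⁺; ++⁺ʳ; map⁺; ++-commutativeMonoid)
open import Data.List.Sort.InsertionSort.Base ≤-decTotalOrder using (sort)
open import Data.List.Sort.InsertionSort.Properties ≤-decTotalOrder using (sort-↭)
open import Algebra.Solver.CommutativeMonoid (++-commutativeMonoid {A = ℕ}) using (solve; _⊕_; _⊜_)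
open import Data.Product using (_,_; proj₁; proj₂)
open import Relation.Nullary using (Dec; yes; no; ¬_)
open import Relation.Nullary.Decidable using (from-yes)
open import Relation.Binary.PropositionalEquality hiding ([_])

length-cartesianProduct : ∀ {A B : Set} (xs : List A) (ys : List B) →
  length (cartesianProduct xs ys) ≡ length xs * length ys
length-cartesianProduct [] ys = refl
length-cartesianProduct (x ∷ xs) ys = begin
  length (map (x ,_) ys ++ cartesianProduct xs ys)
    ≡⟨ length-++ (map (x ,_) ys) ⟩
  length (map (x ,_) ys) + length (cartesianProduct xs ys)
    ≡⟨ cong₂ _+_ (length-map (x ,_) ys) (length-cartesianProduct xs ys) ⟩
  length ys + length xs * length ys ∎
  where open ≡-Reasoning

oneTo-+ : ∀ k m → oneTo (k + m) ≡ oneTo m ++ map (_+ m) (oneTo k)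
oneTo-+ 0 m = sym (++-identityʳ (oneTo m))
oneTo-+ (suc k) m = begin
  oneTo (suc (k + m))                                ≡⟨ applyUpTo-∷ʳ suc (k + m) ⟨
  oneTo (k + m) ∷ʳ (suc k + m)                       ≡⟨ cong (_∷ʳ (suc k + m)) (oneTo-+ k m) ⟩
  (oneTo m ++ map (_+ m) (oneTo k)) ∷ʳ (suc k + m)   ≡⟨ ++-assoc (oneTo m) _ _ ⟩
  oneTo m ++ (map (_+ m) (oneTo k) ∷ʳ (suc k + m))   ≡⟨ cong (oneTo m ++_) (map-++ (_+ m) (oneTo k) _) ⟨
  oneTo m ++ map (_+ m) (oneTo k ∷ʳ suc k)           ≡⟨ cong (λ l → oneTo m ++ map (_+ m) l) (applyUpTo-∷ʳ suc k) ⟩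
  oneTo m ++ map (_+ m) (oneTo (suc k))              ∎
  where open ≡-Reasoning

↭-by-sorting : ∀ {xs ys} → sort xs ≡ ys → xs ↭ ys
↭-by-sorting {xs} sorted = ↭-trans (↭-sym (sort-↭ xs)) (↭-reflexive sorted)

-- Counting wins

beats? : (p : ℕ × ℕ) → Dec (proj₂ p < proj₁ p)
beats? p = proj₂ p <? proj₁ p

length-filter-beats-++ : ∀ ps qs →
  length (filter beats? (ps ++ qs)) ≡ length (filter beats? ps) + length (filter beats? qs)
length-filter-beats-++ ps qs = trans (cong length (filter-++ beats? ps qs)) (length-++ (filter beats? ps))

wins-++ˡ : ∀ X X' Y → wins (X ++ X') Y ≡ wins X Y + wins X' Y
wins-++ˡ X X' Y = trans (cong (length ∘ filter beats?) (cartesianProductWith-distribʳ-++ _,_ X X' Y))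
                        (length-filter-beats-++ (cartesianProduct X Y) _)

wins-singleˡ-++ : ∀ x Y Y' → wins [ x ] (Y ++ Y') ≡ wins [ x ] Y + wins [ x ] Y'
wins-singleˡ-++ x Y Y' = begin
  length (filter beats? (map (x ,_) (Y ++ Y') ++ []))
    ≡⟨ cong (length ∘ filter beats?) (trans (++-identityʳ _) (map-++ (x ,_) Y Y')) ⟩
  length (filter beats? (map (x ,_) Y ++ map (x ,_) Y'))
    ≡⟨ length-filter-beats-++ (map (x ,_) Y) _ ⟩
  length (filter beats? (map (x ,_) Y)) + length (filter beats? (map (x ,_) Y'))
    ≡⟨ cong₂ _+_ (unpad Y) (unpad Y') ⟨
  wins [ x ] Y + wins [ x ] Y' ∎
  where
  open ≡-Reasoning
  unpad : ∀ Z → wins [ x ] Z ≡ length (filter beats? (map (x ,_) Z))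
  unpad Z = cong (length ∘ filter beats?) (++-identityʳ (map (x ,_) Z))

wins-++ʳ : ∀ X Y Y' → wins X (Y ++ Y') ≡ wins X Y + wins X Y'
wins-++ʳ [] Y Y' = refl
wins-++ʳ (x ∷ X) Y Y' = begin
  wins (x ∷ X) (Y ++ Y')                                 ≡⟨ wins-++ˡ [ x ] X (Y ++ Y') ⟩
  wins [ x ] (Y ++ Y') + wins X (Y ++ Y')                ≡⟨ cong₂ _+_ (wins-singleˡ-++ x Y Y') (wins-++ʳ X Y Y') ⟩
  (wins [ x ] Y + wins [ x ] Y') + (wins X Y + wins X Y') ≡⟨ interchange (wins [ x ] Y) _ _ _ ⟩
  (wins [ x ] Y + wins X Y) + (wins [ x ] Y' + wins X Y') ≡⟨ cong₂ _+_ (wins-++ˡ [ x ] X Y) (wins-++ˡ [ x ] X Y') ⟨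
  wins (x ∷ X) Y + wins (x ∷ X) Y'                       ∎
  where open ≡-Reasoning

wins-none : ∀ {p X Y} → All (_≤ p) X → All (p ≤_) Y → wins X Y ≡ 0
wins-none {X = X} {Y} X≤p p≤Y =
  cong length (filter-none beats? (cartesianProduct⁺ (setoid ℕ) (setoid ℕ) X Y loses))
  where
  loses : ∀ {x y} → x ∈ X → y ∈ Y → ¬ y < x
  loses x∈X y∈Y = ≤⇒≯ (≤-trans (All.lookup X≤p x∈X) (All.lookup p≤Y y∈Y))

wins-all : ∀ {p X Y} → All (p <_) X → All (_≤ p) Y → wins X Y ≡ length X * length Y
wins-all {X = X} {Y} p<X Y≤p =
  trans (cong length (filter-all beats? (cartesianProduct⁺ (setoid ℕ) (setoid ℕ) X Y wins-pair)))
        (length-cartesianProduct X Y)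
  where
  wins-pair : ∀ {x y} → x ∈ X → y ∈ Y → y < x
  wins-pair x∈X y∈Y = ≤-<-trans (All.lookup Y≤p y∈Y) (All.lookup p<X x∈X)

wins-single-< : ∀ {x y} → y < x → wins [ x ] [ y ] ≡ 1
wins-single-< y<x = wins-all (y<x ∷ []) (≤-refl ∷ [])

wins-single-≤ : ∀ {x y} → x ≤ y → wins [ x ] [ y ] ≡ 0
wins-single-≤ x≤y = wins-none (≤-refl ∷ []) (x≤y ∷ [])

wins-single-+ : ∀ k x y → wins [ x + k ] [ y + k ] ≡ wins [ x ] [ y ]
wins-single-+ k x y with y <? x
... | yes y<x = trans (wins-single-< (+-monoˡ-< k y<x)) (sym (wins-single-< y<x))
... | no  y≮x = trans (wins-single-≤ (+-monoˡ-≤ k (≮⇒≥ y≮x))) (sym (wins-single-≤ (≮⇒≥ y≮x)))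

wins-singleˡ-map-+ : ∀ k x Y → wins [ x + k ] (map (_+ k) Y) ≡ wins [ x ] Y
wins-singleˡ-map-+ k x [] = refl
wins-singleˡ-map-+ k x (y ∷ Y) = begin
  wins [ x + k ] ([ y + k ] ++ map (_+ k) Y)
    ≡⟨ wins-++ʳ [ x + k ] [ y + k ] (map (_+ k) Y) ⟩
  wins [ x + k ] [ y + k ] + wins [ x + k ] (map (_+ k) Y)
    ≡⟨ cong₂ _+_ (wins-single-+ k x y) (wins-singleˡ-map-+ k x Y) ⟩
  wins [ x ] [ y ] + wins [ x ] Y
    ≡⟨ wins-++ʳ [ x ] [ y ] Y ⟨
  wins [ x ] (y ∷ Y) ∎
  where open ≡-Reasoning

wins-map-+ : ∀ k X Y → wins (map (_+ k) X) (map (_+ k) Y) ≡ wins X Y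
wins-map-+ k [] Y = refl
wins-map-+ k (x ∷ X) Y = begin
  wins ([ x + k ] ++ map (_+ k) X) (map (_+ k) Y)
    ≡⟨ wins-++ˡ [ x + k ] (map (_+ k) X) (map (_+ k) Y) ⟩
  wins [ x + k ] (map (_+ k) Y) + wins (map (_+ k) X) (map (_+ k) Y)
    ≡⟨ cong₂ _+_ (wins-singleˡ-map-+ k x Y) (wins-map-+ k X Y) ⟩
  wins [ x ] Y + wins X Y
    ≡⟨ wins-++ˡ [ x ] X Y ⟨
  wins (x ∷ X) Y ∎
  where open ≡-Reasoning

-- Layered dice and the inductive step

Layered : ℕ → ℕ → Die → Die → Die → Set
Layered p q L M H = All (_≤ p) L × All (λ x → p < x × x ≤ q) M × All (q <_) H

wins-layered : ∀ {p q L M H L' M' H'} → p ≤ q → Layered p q L M H → Layered p q L' M' H' →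
  wins (L ++ M ++ H) (L' ++ M' ++ H') ≡
    wins L L' + wins M M' + wins H H' + (length M * length L' + length H * (length L' + length M'))
wins-layered {p} {q} {L} {M} {H} {L'} {M'} {H'} p≤q (L≤p , M∈ , q<H) (L'≤p , M'∈ , q<H') = begin
  wins (L ++ M ++ H) (L' ++ M' ++ H')
    ≡⟨ trans (wins-++ˡ L (M ++ H) _) (cong (wins L _ +_) (wins-++ˡ M H _)) ⟩
  wins L (L' ++ M' ++ H') + (wins M (L' ++ M' ++ H') + wins H (L' ++ M' ++ H'))
    ≡⟨ cong₂ _+_ (against L) (cong₂ _+_ (against M) (against H)) ⟩
  (wins L L' + (wins L M' + wins L H')) + ((wins M L' + (wins M M' + wins M H'))
    + (wins H L' + (wins H M' + wins H H')))
    ≡⟨ cong₂ _+_ (cong (wins L L' +_) (cong₂ _+_ L-M' L-H'))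
                 (cong₂ _+_ (cong₂ _+_ M-L' (cong (wins M M' +_) M-H'))
                            (cong₂ _+_ H-L' (cong (_+ wins H H') H-M'))) ⟩
  (wins L L' + (0 + 0)) + ((length M * length L' + (wins M M' + 0))
    + (length H * length L' + (length H * length M' + wins H H')))
    ≡⟨ rearrange (wins L L') (wins M M') (wins H H') (length M) (length L') (length H) (length M') ⟩
  wins L L' + wins M M' + wins H H' + (length M * length L' + length H * (length L' + length M')) ∎
  where
  open ≡-Reasoning
  against : ∀ X → wins X (L' ++ M' ++ H') ≡ wins X L' + (wins X M' + wins X H')
  against X = trans (wins-++ʳ X L' (M' ++ H')) (cong (wins X L' +_) (wins-++ʳ X M' H'))
  L≤q : ∀ {K} → All (_≤ p) K → All (_≤ q) K
  L≤q = All.map (λ x≤p → ≤-trans x≤p p≤q)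
  L-M' : wins L M' ≡ 0
  L-M' = wins-none L≤p (All.map (<⇒≤ ∘ proj₁) M'∈)
  L-H' : wins L H' ≡ 0
  L-H' = wins-none (L≤q L≤p) (All.map <⇒≤ q<H')
  M-L' : wins M L' ≡ length M * length L'
  M-L' = wins-all (All.map proj₁ M∈) L'≤p
  M-H' : wins M H' ≡ 0
  M-H' = wins-none (All.map proj₂ M∈) (All.map <⇒≤ q<H')
  H-L' : wins H L' ≡ length H * length L'
  H-L' = wins-all q<H (L≤q L'≤p)
  H-M' : wins H M' ≡ length H * length M'
  H-M' = wins-all q<H (All.map proj₂ M'∈)
  rearrange : ∀ a b c m l h m' →
    (a + (0 + 0)) + ((m * l + (b + 0)) + (h * l + (h * m' + c))) ≡ a + b + c + (m * l + h * (l + m'))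
  rearrange = solve-∀

InRange : ℕ → ℕ → Set
InRange N x = 0 < x × x ≤ N

top : ℕ → ℕ → ℕ
top n i = i + (4 * n + 4)

grow : (n lo i : ℕ) → Die → Die
grow n lo i X = lo ∷ map (_+ 4) X ++ [ top n i ]

grow-layered : ∀ {n lo i X} → lo ≤ 4 → 0 < i → All (InRange (4 * n)) X →
  Layered 4 (4 * n + 4) [ lo ] (map (_+ 4) X) [ top n i ]
grow-layered {n} lo≤4 0<i X∈ =
  lo≤4 ∷ [] ,
  All-map⁺ (All.map (λ (0<x , x≤N) → +-monoˡ-≤ 4 0<x , +-monoˡ-≤ 4 x≤N) X∈) ,
  m<n+m (4 * n + 4) 0<i ∷ []

wins-grow : ∀ {n lo lo' i i' X Y} → lo ≤ 4 → lo' ≤ 4 → 0 < i → 0 < i' →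
  All (InRange (4 * n)) X → All (InRange (4 * n)) Y →
  wins (grow n lo i X) (grow n lo' i' Y) ≡
    (wins [ lo ] [ lo' ] + wins [ top n i ] [ top n i' ]) + wins X Y + (length X + suc (length Y))
wins-grow {n} {lo} {lo'} {i} {i'} {X} {Y} lo≤4 lo'≤4 0<i 0<i' X∈ Y∈ = begin
  wins (grow n lo i X) (grow n lo' i' Y)
    ≡⟨ wins-layered (m≤n+m 4 (4 * n)) (grow-layered {n} lo≤4 0<i X∈) (grow-layered {n} lo'≤4 0<i' Y∈) ⟩
  wins [ lo ] [ lo' ] + wins X⁺ Y⁺ + wins [ top n i ] [ top n i' ] + (length X⁺ * 1 + 1 * suc (length Y⁺))
    ≡⟨ cong₂ _+_ (cong (λ w → wins [ lo ] [ lo' ] + w + wins [ top n i ] [ top n i' ]) (wins-map-+ 4 X Y))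
                 (cong₂ _+_ (trans (*-identityʳ _) (length-map (_+ 4) X))
                            (trans (*-identityˡ _) (cong suc (length-map (_+ 4) Y)))) ⟩
  wins [ lo ] [ lo' ] + wins X Y + wins [ top n i ] [ top n i' ] + (length X + suc (length Y))
    ≡⟨ cong (_+ (length X + suc (length Y))) (swap-last (wins [ lo ] [ lo' ]) _ _) ⟩
  (wins [ lo ] [ lo' ] + wins [ top n i ] [ top n i' ]) + wins X Y + (length X + suc (length Y)) ∎
  where
  open ≡-Reasoning
  X⁺ = map (_+ 4) X
  Y⁺ = map (_+ 4) Y
  swap-last : ∀ a b c → a + b + c ≡ a + c + b
  swap-last = solve-∀

faces-inRange : ∀ {n} A B C D → IsDiceSet n A B C D → All (InRange (4 * n)) (A ++ B ++ C ++ D)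
faces-inRange {n} _ _ _ _ (_ , _ , _ , _ , perm) =
  All-resp-↭ (↭-sym perm) (applyUpTo⁺₁ suc (4 * n) (λ i<4n → z<s , i<4n))

↭-regroup : ∀ (l₁ m₁ h₁ l₂ m₂ h₂ l₃ m₃ h₃ l₄ m₄ h₄ : List ℕ) →
  (l₁ ++ m₁ ++ h₁) ++ (l₂ ++ m₂ ++ h₂) ++ (l₃ ++ m₃ ++ h₃) ++ (l₄ ++ m₄ ++ h₄) ↭
  ((l₁ ++ l₂ ++ l₃ ++ l₄) ++ (m₁ ++ m₂ ++ m₃ ++ m₄)) ++ (h₁ ++ h₂ ++ h₃ ++ h₄)
↭-regroup = solve 12
  (λ l₁ m₁ h₁ l₂ m₂ h₂ l₃ m₃ h₃ l₄ m₄ h₄ →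
    (l₁ ⊕ m₁ ⊕ h₁) ⊕ (l₂ ⊕ m₂ ⊕ h₂) ⊕ (l₃ ⊕ m₃ ⊕ h₃) ⊕ (l₄ ⊕ m₄ ⊕ h₄) ⊜
    ((l₁ ⊕ l₂ ⊕ l₃ ⊕ l₄) ⊕ (m₁ ⊕ m₂ ⊕ m₃ ⊕ m₄)) ⊕ (h₁ ⊕ h₂ ⊕ h₃ ⊕ h₄))
  ↭-refl

grow-isDiceSet : ∀ {n} A B C D → IsDiceSet n A B C D →
  IsDiceSet (2 + n) (grow n 4 1 A) (grow n 3 2 B) (grow n 2 3 C) (grow n 1 4 D)
grow-isDiceSet {n} A B C D (|A| , |B| , |C| , |D| , perm) =
  length-grow 4 1 A |A| , length-grow 3 2 B |B| , length-grow 2 3 C |C| , length-grow 1 4 D |D| , grown-perm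
  where
  length-grow : ∀ lo i X → length X ≡ n → length (grow n lo i X) ≡ 2 + n
  length-grow lo i X |X| = cong suc (begin
    length (map (_+ 4) X ++ [ top n i ])   ≡⟨ length-++ (map (_+ 4) X) ⟩
    length (map (_+ 4) X) + 1             ≡⟨ +-comm _ 1 ⟩
    suc (length (map (_+ 4) X))           ≡⟨ cong suc (trans (length-map (_+ 4) X) |X|) ⟩
    suc n                                 ∎)
    where open ≡-Reasoning
  shifted : map (_+ 4) A ++ map (_+ 4) B ++ map (_+ 4) C ++ map (_+ 4) D ↭ map (_+ 4) (oneTo (4 * n))
  shifted = ↭-trans (↭-reflexive (sym map-++₄)) (map⁺ (_+ 4) perm)
    where
    map-++₄ : map (_+ 4) (A ++ B ++ C ++ D) ≡ map (_+ 4) A ++ map (_+ 4) B ++ map (_+ 4) C ++ map (_+ 4) D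
    map-++₄ = trans (map-++ (_+ 4) A _) (cong (map (_+ 4) A ++_)
                (trans (map-++ (_+ 4) B _) (cong (map (_+ 4) B ++_) (map-++ (_+ 4) C D))))
  grown-perm : grow n 4 1 A ++ grow n 3 2 B ++ grow n 2 3 C ++ grow n 1 4 D ↭ oneTo (4 * (2 + n))
  grown-perm = begin
    grow n 4 1 A ++ grow n 3 2 B ++ grow n 2 3 C ++ grow n 1 4 D
      ↭⟨ ↭-regroup [ 4 ] (map (_+ 4) A) [ top n 1 ] [ 3 ] (map (_+ 4) B) [ top n 2 ]
                   [ 2 ] (map (_+ 4) C) [ top n 3 ] [ 1 ] (map (_+ 4) D) [ top n 4 ] ⟩
    ((4 ∷ 3 ∷ 2 ∷ 1 ∷ []) ++ (map (_+ 4) A ++ map (_+ 4) B ++ map (_+ 4) C ++ map (_+ 4) D))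
      ++ map (_+ (4 * n + 4)) (oneTo 4)
      ↭⟨ ++⁺ʳ (map (_+ (4 * n + 4)) (oneTo 4)) (++⁺ (↭-reverse (oneTo 4)) shifted) ⟩
    (oneTo 4 ++ map (_+ 4) (oneTo (4 * n))) ++ map (_+ (4 * n + 4)) (oneTo 4)
      ≡⟨ trans (oneTo-+ 4 (4 * n + 4)) (cong (_++ map (_+ (4 * n + 4)) (oneTo 4)) (oneTo-+ (4 * n) 4)) ⟨
    oneTo (4 + (4 * n + 4))
      ≡⟨ cong oneTo (size n) ⟩
    oneTo (4 * (2 + n)) ∎
    where
    open PermutationReasoning
    size : ∀ n → 4 + (4 * n + 4) ≡ 4 * (2 + n)
    size = solve-∀

record BalancedCycle (n : ℕ) : Set where
  field
    A B C D : Die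
    isDiceSet : IsDiceSet n A B C D
    W : ℕ
    wins-AB : wins A B ≡ W
    wins-BC : wins B C ≡ W
    wins-CD : wins C D ≡ W
    wins-DA : wins D A ≡ W
    n²<2W : n * n < W + W

grow-cycle : ∀ {n} → BalancedCycle n → BalancedCycle (2 + n)
grow-cycle {n} cycle = record
  { A = grow n 4 1 A
  ; B = grow n 3 2 B
  ; C = grow n 2 3 C
  ; D = grow n 1 4 D
  ; isDiceSet = grow-isDiceSet A B C D isDiceSet
  ; W = W'
  ; wins-AB = trans (wins-grow {n} {4} {3} {1} {2} ≤-refl 3≤4 z<s z<s A∈ B∈)
                    (settle (cong suc (wins-single-≤ {top n 1} {top n 2} (n≤1+n (top n 1)))) wins-AB |A| |B|)
  ; wins-BC = trans (wins-grow {n} {3} {2} {2} {3} 3≤4 2≤4 z<s z<s B∈ C∈)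
                    (settle (cong suc (wins-single-≤ {top n 2} {top n 3} (n≤1+n (top n 2)))) wins-BC |B| |C|)
  ; wins-CD = trans (wins-grow {n} {2} {1} {3} {4} 2≤4 1≤4 z<s z<s C∈ D∈)
                    (settle (cong suc (wins-single-≤ {top n 3} {top n 4} (n≤1+n (top n 3)))) wins-CD |C| |D|)
  ; wins-DA = trans (wins-grow {n} {1} {4} {4} {1} 1≤4 ≤-refl z<s z<s D∈ A∈)
                    (settle (wins-single-< {top n 4} {top n 1} (+-monoˡ-< (4 * n + 4) 1<4)) wins-DA |D| |A|)
  ; n²<2W = grown-n²<2W
  }
  where
  open BalancedCycle cycle
  |A| : length A ≡ n
  |A| = proj₁ isDiceSet
  |B| : length B ≡ n
  |B| = proj₁ (proj₂ isDiceSet)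
  |C| : length C ≡ n
  |C| = proj₁ (proj₂ (proj₂ isDiceSet))
  |D| : length D ≡ n
  |D| = proj₁ (proj₂ (proj₂ (proj₂ isDiceSet)))
  faces : All (InRange (4 * n)) (A ++ B ++ C ++ D)
  faces = faces-inRange A B C D isDiceSet
  A∈ : All (InRange (4 * n)) A
  A∈ = ++⁻ˡ A faces
  B∈ : All (InRange (4 * n)) B
  B∈ = ++⁻ˡ B (++⁻ʳ A faces)
  C∈ : All (InRange (4 * n)) C
  C∈ = ++⁻ˡ C (++⁻ʳ B (++⁻ʳ A faces))
  D∈ : All (InRange (4 * n)) D
  D∈ = ++⁻ʳ C (++⁻ʳ B (++⁻ʳ A faces))
  1≤4 : 1 ≤ 4
  1≤4 = s≤s z≤n
  2≤4 : 2 ≤ 4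
  2≤4 = s≤s (s≤s z≤n)
  3≤4 : 3 ≤ 4
  3≤4 = s≤s (s≤s (s≤s z≤n))
  1<4 : 1 < 4
  1<4 = s≤s (s≤s z≤n)
  W' : ℕ
  W' = 1 + W + (n + suc n)
  settle : ∀ {e w x y} → e ≡ 1 → w ≡ W → x ≡ n → y ≡ n → e + w + (x + suc y) ≡ W'
  settle refl refl refl refl = refl
  grown-n²<2W : (2 + n) * (2 + n) < W' + W'
  grown-n²<2W = subst₂ _≤_ (square n) (double n W) (+-monoˡ-≤ (4 * n + 4) n²<2W)
    where
    square : ∀ n → suc (n * n) + (4 * n + 4) ≡ suc ((2 + n) * (2 + n))
    square = solve-∀
    double : ∀ n W → (W + W) + (4 * n + 4) ≡ (1 + W + (n + suc n)) + (1 + W + (n + suc n))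
    double = solve-∀

cycle₃ : BalancedCycle 3
cycle₃ = record
  { A = 1 ∷ 8 ∷ 10 ∷ []
  ; B = 5 ∷ 7 ∷ 9 ∷ []
  ; C = 2 ∷ 6 ∷ 12 ∷ []
  ; D = 3 ∷ 4 ∷ 11 ∷ []
  ; isDiceSet = refl , refl , refl , refl , ↭-by-sorting refl
  ; W = 5
  ; wins-AB = refl
  ; wins-BC = refl
  ; wins-CD = refl
  ; wins-DA = refl
  ; n²<2W = from-yes (9 <? 10)
  }

cycle₄ : BalancedCycle 4
cycle₄ = record
  { A = 4 ∷ 7 ∷ 8 ∷ 16 ∷ []
  ; B = 3 ∷ 5 ∷ 12 ∷ 15 ∷ []
  ; C = 2 ∷ 6 ∷ 11 ∷ 14 ∷ []
  ; D = 1 ∷ 9 ∷ 10 ∷ 13 ∷ []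
  ; isDiceSet = refl , refl , refl , refl , ↭-by-sorting refl
  ; W = 9
  ; wins-AB = refl
  ; wins-BC = refl
  ; wins-CD = refl
  ; wins-DA = refl
  ; n²<2W = from-yes (16 <? 18)
  }

balancedCycle : ∀ m → BalancedCycle (3 + m)
balancedCycle 0 = cycle₃
balancedCycle 1 = cycle₄
balancedCycle (suc (suc m)) = grow-cycle (balancedCycle m)

-- Probabilities

½<W/d : ∀ W d .{{_ : NonZero d}} → d < W + W → ½ <ℚ ℤ.+ W / d
½<W/d W (suc k) d<2W =
  toℚᵘ-cancel-< (<-respʳ-≃ (≃-sym (toℚᵘ-fromℚᵘ (mkℚᵘ (ℤ.+ W) k))) (*<* 1*d<W*2))
  where
  1*d<W*2 : ℤ.+ 1 ℤ.* ℤ.+ suc k ℤ.< ℤ.+ W ℤ.* ℤ.+ 2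
  1*d<W*2 = subst₂ ℤ._<_ (ℤ.pos-* 1 (suc k)) (ℤ.pos-* W 2)
              (ℤ.+<+ (subst₂ _<_ (sym (*-identityˡ (suc k))) (double W) d<2W))
    where
    double : ∀ W → W + W ≡ W * 2
    double = solve-∀

P≻-cong : ∀ n .{{_ : NonZero n}} X Y X' Y' → wins X Y ≡ wins X' Y' → P≻ n X Y ≡ P≻ n X' Y'
P≻-cong n _ _ _ _ eq = cong (λ w → _/_ (ℤ.+ w) (n * n) {{m*n≢0 n n}}) eq

½<P≻ : ∀ n .{{_ : NonZero n}} X Y {W} → wins X Y ≡ W → n * n < W + W → ½ <ℚ P≻ n X Y
½<P≻ n _ _ {W} refl = ½<W/d W (n * n) {{m*n≢0 n n}}

theorem4p6 : (m : ℕ) → Σ Die λ A → Σ Die λ B → Σ Die λ C → Σ Die λ D →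
    IsDiceSet (3 + m) A B C D × Balanced (3 + m) A B C D × NonTransitive (3 + m) A B C D
theorem4p6 m =
  A , B , C , D , isDiceSet ,
  (P≻-cong n A B B C (trans wins-AB (sym wins-BC)) ,
   P≻-cong n B C C D (trans wins-BC (sym wins-CD)) ,
   P≻-cong n C D D A (trans wins-CD (sym wins-DA))) ,
  (½<P≻ n A B wins-AB n²<2W , ½<P≻ n B C wins-BC n²<2W ,
   ½<P≻ n C D wins-CD n²<2W , ½<P≻ n D A wins-DA n²<2W)
  where
  n = 3 + m
  open BalancedCycle (balancedCycle m)
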